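{- Let $G$ be a finite simple graph, with $(H,H')$, $M$, $M_A$ as in the standing setting below. Then $C(M_A,H')=P_e(M_A,H')=P_o^{M_A}(M_A,H')=\emptyset$.
   Context: $\nu(G)$ is the maximum matching size. $B_2(G)$ is the set of pairs $(H,H')$ of edge-disjoint matchings; $\lambda_2(G)=\max\{|H|+|H'|:(H,H')\in B_2(G)\}$; $\alpha_2(G)=\max\{|H|,|H'|:(H,H')\in B_2(G),\ |H|+|H'|=\lambda_2(G)\}$; $M_2(G)=\{(H,H')\in B_2(G): |H|+|H'|=\lambda_2(G),\ |H|=\alpha_2(G)\}$. For matchings $A,B$: a path or even cycle $e_1,\dots,e_l$ ($l\ge1$) is $A$-$B$ alternating if the edges with odd indices lie in $A\setminus B$ and the others in $B\setminus A$, or vice versa; an alternating path is maximal if it is not a proper subpath of another $A$-$B$ alternating path. $C(A,B)$ is the set of $A$-$B$ alternating cycles, $P_e(A,B)$ the set of maximal $A$-$B$ alternating paths of even length, and $P_o^A(A,B)$ the set of maximal $A$-$B$ alternating paths of odd length whose first edge is in $A$. Standing setting: over all $(H,H')\in M_2(G)$ and all maximum matchings $M$ of $G$, consider the triples maximizing $|M\cap H|$; among these, $((H,H'),M)$ is chosen to maximize $|M\cap H'|$. $M_A$ is the set of edges lying on paths of $P_o^M(M,H)$ that belong to $M$ (a matching). -}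

module Defs where

open import Data.Nat using (ℕ; zero; suc; _+_; _*_; _≤_; _<_; _<ᵇ_)
open import Data.Fin using (Fin; toℕ)
open import Data.Bool using (Bool; true; false; _∧_; if_then_else_)
open import Data.List using (List; []; _∷_; _++_; length; reverse; map; allFin)
open import Data.Nat.ListAction using (sum)
open import Data.List.Relation.Unary.Unique.Propositional using (Unique)
open import Data.Product using (Σ; ∃; ∃-syntax; _×_; _,_)
open import Data.Sum using (_⊎_)
open import Data.Empty using (⊥)
open import Data.Unit using (⊤)
open import Relation.Nullary using (¬_)
open import Relation.Binary.PropositionalEquality using (_≡_)

record Graph (n : ℕ) : Set where
  field
    adj     : Fin n → Fin n → Bool
    adj-sym : ∀ u v → adj u v ≡ adj v u
    irrefl  : ∀ u → adj u u ≡ false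
open Graph public

-- (decidable) sets of edges, given as a symmetric Boolean relation
EdgeSet : ℕ → Set
EdgeSet n = Fin n → Fin n → Bool

esize : ∀ {n} → EdgeSet n → ℕ
esize {n} S = sum (map (λ u → sum (map (λ v →
  if (toℕ u <ᵇ toℕ v) ∧ S u v then 1 else 0) (allFin n))) (allFin n))

_∩_ : ∀ {n} → EdgeSet n → EdgeSet n → EdgeSet n
(A ∩ B) u v = A u v ∧ B u v

IsMatching : ∀ {n} → Graph n → EdgeSet n → Set
IsMatching {n} G S =
  (∀ u v → S u v ≡ S v u) ×
  (∀ u v → S u v ≡ true → adj G u v ≡ true) ×
  (∀ u v w → S u v ≡ true → S u w ≡ true → v ≡ w)

IsMaximumMatching : ∀ {n} → Graph n → EdgeSet n → Set
IsMaximumMatching G M =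
  IsMatching G M × (∀ N → IsMatching G N → esize N ≤ esize M)

InB2 : ∀ {n} → Graph n → EdgeSet n → EdgeSet n → Set
InB2 G H H' = IsMatching G H × IsMatching G H' × (∀ u v → H u v ≡ true → H' u v ≡ false)

IsLambda2 : ∀ {n} → Graph n → EdgeSet n → EdgeSet n → Set
IsLambda2 G H H' = InB2 G H H' ×
  (∀ K K' → InB2 G K K' → esize K + esize K' ≤ esize H + esize H')

-- (H,H') ∈ M₂(G): |H|+|H'| = λ₂(G) and |H| = α₂(G), where
-- α₂(G) = max{|K|,|K'| : (K,K') ∈ B₂(G), |K|+|K'| = λ₂(G)}
InM2 : ∀ {n} → Graph n → EdgeSet n → EdgeSet n → Set
InM2 G H H' = IsLambda2 G H H' ×
  (∀ K K' → InB2 G K K' → esize K + esize K' ≡ esize H + esize H' →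
     (esize K ≤ esize H) × (esize K' ≤ esize H))

StandingSetting : ∀ {n} → Graph n → EdgeSet n → EdgeSet n → EdgeSet n → Set
StandingSetting G H H' M =
  InM2 G H H' × IsMaximumMatching G M ×
  (∀ K K' N → InM2 G K K' → IsMaximumMatching G N →
     esize (N ∩ K) ≤ esize (M ∩ H)) ×
  (∀ K K' N → InM2 G K K' → IsMaximumMatching G N →
     esize (N ∩ K) ≡ esize (M ∩ H) → esize (N ∩ K') ≤ esize (M ∩ H'))

ERel : ℕ → Set₁
ERel n = Fin n → Fin n → Set

toRel : ∀ {n} → EdgeSet n → ERel n
toRel S u v = S u v ≡ true

InDiff : ∀ {n} → ERel n → ERel n → Fin n → Fin n → Set
InDiff A B u v = A u v × ¬ B u v

AltFrom : ∀ {n} → ERel n → ERel n → Bool → List (Fin n) → Set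
AltFrom A B b [] = ⊤
AltFrom A B b (x ∷ []) = ⊤
AltFrom A B true  (x ∷ y ∷ r) = InDiff A B x y × AltFrom A B false (y ∷ r)
AltFrom A B false (x ∷ y ∷ r) = InDiff B A x y × AltFrom A B true (y ∷ r)

Even : ℕ → Set
Even m = ∃[ k ] m ≡ 2 * k

Odd : ℕ → Set
Odd m = ∃[ k ] m ≡ suc (2 * k)

nEdges : ∀ {n} → List (Fin n) → ℕ
nEdges [] = 0
nEdges (x ∷ xs) = length xs

AltPath : ∀ {n} → ERel n → ERel n → List (Fin n) → Set
AltPath A B vs = Unique vs × 2 ≤ length vs × ∃[ b ] AltFrom A B b vs

ProperSubpath : ∀ {n} → List (Fin n) → List (Fin n) → Set
ProperSubpath vs ws = length vs < length ws ×
  ((∃[ p ] ∃[ s ] ws ≡ p ++ vs ++ s) ⊎ (∃[ p ] ∃[ s ] ws ≡ p ++ reverse vs ++ s))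

MaxAltPath : ∀ {n} → ERel n → ERel n → List (Fin n) → Set
MaxAltPath A B vs = AltPath A B vs ×
  ¬ (∃[ ws ] AltPath A B ws × ProperSubpath vs ws)

close : ∀ {n} → List (Fin n) → List (Fin n)
close [] = []
close (x ∷ xs) = x ∷ xs ++ (x ∷ [])

AltCycle : ∀ {n} → ERel n → ERel n → List (Fin n) → Set
AltCycle A B vs = Unique vs × 3 ≤ length vs × Even (length vs) ×
  ∃[ b ] AltFrom A B b (close vs)

InC : ∀ {n} → ERel n → ERel n → List (Fin n) → Set
InC = AltCycle

InPe : ∀ {n} → ERel n → ERel n → List (Fin n) → Set
InPe A B vs = MaxAltPath A B vs × Even (nEdges vs)

InPoA : ∀ {n} → ERel n → ERel n → List (Fin n) → Set
InPoA A B vs = MaxAltPath A B vs × Odd (nEdges vs) × AltFrom A B true vs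

EdgeOn : ∀ {n} → Fin n → Fin n → List (Fin n) → Set
EdgeOn u v [] = ⊥
EdgeOn u v (x ∷ []) = ⊥
EdgeOn u v (x ∷ y ∷ r) = ((x ≡ u × y ≡ v) ⊎ (x ≡ v × y ≡ u)) ⊎ EdgeOn u v (y ∷ r)

MA : ∀ {n} → EdgeSet n → EdgeSet n → ERel n
MA M H u v = M u v ≡ true ×
  ∃[ vs ] InPoA (toRel M) (toRel H) vs × EdgeOn u v vs

-- Let A be any symmetric set of edges of M disjoint from H (M_A is one, since an M-H alternating
-- path starting with M alternates M \ H and H \ M). Suppose W is an A-H' alternating cycle, a
-- maximal even path, or a maximal odd path starting with A, and replace H' by H' Δ W. Maximality
-- of the path (and, for odd paths, the absence of alternating cycles) guarantees that no H'-edge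
-- leaves W at a vertex of an A-step, so H' Δ W is again a matching; it avoids H and, as W has at
-- least as many A-steps as H'-steps, is no smaller than H', so (H, H' Δ W) ∈ M₂. Every H'-step of
-- W is adjacent to an A-step, so as M is a matching containing A, no H'-step of W lies in M, while
-- all its A-steps do. Hence |M ∩ (H' Δ W)| > |M ∩ H'|, contradicting the choice of ((H,H'),M).
module Submission where

open import Data.Bool using (Bool; true; false; _∧_; _∨_; _xor_; not; if_then_else_)
open import Data.Bool.Properties
  using (¬-not; not-involutive; ∧-comm; ∧-zeroʳ; ∧-identityʳ; ∧-distribʳ-∨; ∨-identityʳ)
open import Data.Empty using (⊥; ⊥-elim)
open import Data.Fin using (Fin; toℕ) renaming (zero to fzero; suc to fsuc)
open import Data.Fin.Properties using (_≟_; toℕ-injective)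
open import Data.List using (List; []; _∷_; _++_; length; map; tabulate; allFin)
open import Data.List.Properties using (map-cong; length-++; ++-identityʳ)
open import Data.List.Membership.Propositional using (_∈_; _∉_)
open import Data.List.Relation.Unary.All using ([]; _∷_)
open import Data.List.Relation.Unary.All.Properties.Core using (All¬⇒¬Any; ¬Any⇒All¬)
open import Data.List.Relation.Unary.AllPairs using ([]; _∷_)
import Data.List.Relation.Unary.AllPairs as AllPairs
open import Data.List.Relation.Unary.Any using (here; there)
open import Data.List.Relation.Unary.Unique.Propositional using (Unique)
import Data.List.Relation.Unary.Unique.Propositional.Properties as Unique
open import Data.Nat using (ℕ; zero; suc; z≤n; s≤s; _+_; _*_; _≤_; _<_; _<ᵇ_; ⌊_/2⌋; ⌈_/2⌉)
open import Data.Nat.ListAction using (sum)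
open import Data.Nat.Properties
  using ( +-*-semiring; +-identityʳ; +-suc; +-comm; suc-injective; n≡⌊n+n/2⌋; n≡⌈n+n/2⌉
        ; ≤-refl; ≤-reflexive; ≤-trans; ≤-antisym; n≤1+n; <-irrefl; <⇒≱; m<m+n
        ; +-monoʳ-≤; +-cancelʳ-≤ )
open import Data.Product using (_×_; _,_; proj₁; proj₂; ∃-syntax; uncurry)
import Data.Product as Product
open import Data.Sum using (_⊎_; inj₁; inj₂)
open import Data.Unit using (⊤; tt)
open import Function using (_∘_; id)
open import Function.Bundles using (mk⇔)
open import Relation.Nullary using (¬_; Dec; yes; no; does; _×-dec_; _⊎-dec_)
open import Relation.Nullary.Decidable using (does-⇔; dec-false)
open import Relation.Binary.PropositionalEquality

open import Defs

open import Algebra.Properties.Semiring.Sum +-*-semiring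
  using (sum-syntax; sum-cong-≗; sum-replicate-zero; ∑-distrib-+; *-distribˡ-sum) renaming (sum to ∑)

private variable n : ℕ

-- Counting edges

⟦_⟧ : Bool → ℕ
⟦ b ⟧ = if b then 1 else 0

IsSymmetric : EdgeSet n → Set
IsSymmetric S = ∀ u v → S u v ≡ S v u

∅ : EdgeSet n
∅ _ _ = false

_∪_ : EdgeSet n → EdgeSet n → EdgeSet n
(S ∪ T) u v = S u v ∨ T u v

_∖_ : EdgeSet n → EdgeSet n → EdgeSet n
(S ∖ T) u v = S u v ∧ not (T u v)

_Δ_ : EdgeSet n → EdgeSet n → EdgeSet n
(S Δ T) u v = S u v xor T u v

_<ᶠ_ : Fin n → Fin n → Bool
u <ᶠ v = toℕ u <ᵇ toℕ v

∑² : (Fin n → Fin n → ℕ) → ℕ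
∑² {n} f = ∑[ u < n ] ∑[ v < n ] f u v

∑²-cong : {f g : Fin n → Fin n → ℕ} → (∀ u v → f u v ≡ g u v) → ∑² f ≡ ∑² g
∑²-cong {n} f≗g = sum-cong-≗ {n} (λ u → sum-cong-≗ (f≗g u))

∑²-distrib-+ : (f g : Fin n → Fin n → ℕ) → ∑² (λ u v → f u v + g u v) ≡ ∑² f + ∑² g
∑²-distrib-+ {n} f g =
  trans (sum-cong-≗ (λ u → ∑-distrib-+ (f u) (g u))) (∑-distrib-+ {n} (λ u → ∑ (f u)) (λ u → ∑ (g u)))

∑-zero : (f : Fin n → ℕ) → (∀ i → f i ≡ 0) → ∑ f ≡ 0
∑-zero {n} f f≗0 = trans (sum-cong-≗ f≗0) (sum-replicate-zero n)

∑²-zero : (f : Fin n → Fin n → ℕ) → (∀ u v → f u v ≡ 0) → ∑² f ≡ 0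
∑²-zero {n} f f≗0 = ∑-zero (λ u → ∑ (f u)) (λ u → ∑-zero (f u) (f≗0 u))

∑-point : (a : Fin n) (f : Fin n → ℕ) → ∑[ v < n ] (⟦ does (a ≟ v) ⟧ * f v) ≡ f a
∑-point {suc n} fzero    f = trans (cong₂ _+_ (+-identityʳ (f fzero)) (∑-zero {n} _ (λ _ → refl))) (+-identityʳ _)
∑-point {suc n} (fsuc a) f = ∑-point a (f ∘ fsuc)

sum-map-tabulate : ∀ {A : Set} (g : Fin n → A) (f : A → ℕ) → sum (map f (tabulate g)) ≡ ∑ (f ∘ g)
sum-map-tabulate {zero}  g f = refl
sum-map-tabulate {suc n} g f = cong (f (g fzero) +_) (sum-map-tabulate (g ∘ fsuc) f)

esize≡∑² : (S : EdgeSet n) → esize S ≡ ∑² (λ u v → ⟦ (u <ᶠ v) ∧ S u v ⟧)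
esize≡∑² {n} S = trans (sum-map-tabulate id (λ u → sum (map (⟦S⟧ u) (allFin n))))
                        (sum-cong-≗ (λ u → sum-map-tabulate id (⟦S⟧ u)))
  where
  ⟦S⟧ : Fin n → Fin n → ℕ
  ⟦S⟧ u v = ⟦ (u <ᶠ v) ∧ S u v ⟧

esize-cong : {S T : EdgeSet n} → (∀ u v → S u v ≡ T u v) → esize S ≡ esize T
esize-cong {n} S≗T =
  cong sum (map-cong (λ u → cong sum (map-cong (λ v → cong (λ b → ⟦ (u <ᶠ v) ∧ b ⟧) (S≗T u v)) (allFin n))) (allFin n))

esize-∅ : esize (∅ {n}) ≡ 0
esize-∅ {n} = trans (esize≡∑² (∅ {n})) (∑²-zero {n} _ (λ u v → cong ⟦_⟧ (∧-zeroʳ (u <ᶠ v))))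

esize-∪-∩ : (S T : EdgeSet n) → esize (S ∪ T) + esize (S ∩ T) ≡ esize S + esize T
esize-∪-∩ {n} S T = begin
  esize (S ∪ T) + esize (S ∩ T)
    ≡⟨ cong₂ _+_ (esize≡∑² (S ∪ T)) (esize≡∑² (S ∩ T)) ⟩
  ∑² (λ u v → ⟦ (u <ᶠ v) ∧ (S u v ∨ T u v) ⟧) + ∑² (λ u v → ⟦ (u <ᶠ v) ∧ (S u v ∧ T u v) ⟧)
    ≡⟨ sym (∑²-distrib-+ {n} _ _) ⟩
  ∑² (λ u v → ⟦ (u <ᶠ v) ∧ (S u v ∨ T u v) ⟧ + ⟦ (u <ᶠ v) ∧ (S u v ∧ T u v) ⟧)
    ≡⟨ ∑²-cong {n} (λ u v → inclusion-exclusion (u <ᶠ v) (S u v) (T u v)) ⟩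
  ∑² (λ u v → ⟦ (u <ᶠ v) ∧ S u v ⟧ + ⟦ (u <ᶠ v) ∧ T u v ⟧)
    ≡⟨ ∑²-distrib-+ {n} _ _ ⟩
  ∑² (λ u v → ⟦ (u <ᶠ v) ∧ S u v ⟧) + ∑² (λ u v → ⟦ (u <ᶠ v) ∧ T u v ⟧)
    ≡⟨ sym (cong₂ _+_ (esize≡∑² S) (esize≡∑² T)) ⟩
  esize S + esize T ∎
  where
  open ≡-Reasoning
  inclusion-exclusion : ∀ a s t → ⟦ a ∧ (s ∨ t) ⟧ + ⟦ a ∧ (s ∧ t) ⟧ ≡ ⟦ a ∧ s ⟧ + ⟦ a ∧ t ⟧
  inclusion-exclusion false s     t     = refl
  inclusion-exclusion true  true  true  = refl
  inclusion-exclusion true  true  false = refl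
  inclusion-exclusion true  false true  = refl
  inclusion-exclusion true  false false = refl

esize-∪ : (S T : EdgeSet n) → (∀ u v → (S ∩ T) u v ≡ false) → esize (S ∪ T) ≡ esize S + esize T
esize-∪ {n} S T disjoint = begin
  esize (S ∪ T)                 ≡⟨ sym (+-identityʳ _) ⟩
  esize (S ∪ T) + 0             ≡⟨ cong (esize (S ∪ T) +_) (sym (esize-∅ {n})) ⟩
  esize (S ∪ T) + esize (∅ {n}) ≡⟨ cong (esize (S ∪ T) +_) (esize-cong (λ u v → sym (disjoint u v))) ⟩
  esize (S ∪ T) + esize (S ∩ T) ≡⟨ esize-∪-∩ S T ⟩
  esize S + esize T             ∎
  where open ≡-Reasoning

esize-Δ : (S T : EdgeSet n) → esize (S Δ T) + esize (T ∩ S) ≡ esize S + esize (T ∖ S)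
esize-Δ {n} S T = begin
  esize (S Δ T) + esize (T ∩ S) ≡⟨ sym (esize-∪ (S Δ T) (T ∩ S) (λ u v → Δ-∩-disjoint (S u v) (T u v))) ⟩
  esize ((S Δ T) ∪ (T ∩ S))     ≡⟨ esize-cong {n} (λ u v → Δ∪∩≡∪∖ (S u v) (T u v)) ⟩
  esize (S ∪ (T ∖ S))           ≡⟨ esize-∪ S (T ∖ S) (λ u v → ∖-disjoint (S u v) (T u v)) ⟩
  esize S + esize (T ∖ S)       ∎
  where
  open ≡-Reasoning
  Δ-∩-disjoint : ∀ s t → (s xor t) ∧ (t ∧ s) ≡ false
  Δ-∩-disjoint true  true  = refl
  Δ-∩-disjoint true  false = refl
  Δ-∩-disjoint false true  = refl
  Δ-∩-disjoint false false = refl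
  Δ∪∩≡∪∖ : ∀ s t → (s xor t) ∨ (t ∧ s) ≡ s ∨ (t ∧ not s)
  Δ∪∩≡∪∖ true  true  = refl
  Δ∪∩≡∪∖ true  false = refl
  Δ∪∩≡∪∖ false true  = refl
  Δ∪∩≡∪∖ false false = refl
  ∖-disjoint : ∀ s t → s ∧ (t ∧ not s) ≡ false
  ∖-disjoint true  t = ∧-zeroʳ t
  ∖-disjoint false t = refl

arc : Fin n → Fin n → EdgeSet n
arc x y u v = does (x ≟ u) ∧ does (y ≟ v)

esize-arc : (x y : Fin n) → esize (arc x y) ≡ ⟦ x <ᶠ y ⟧
esize-arc {n} x y = begin
  esize (arc x y)
    ≡⟨ esize≡∑² (arc x y) ⟩
  ∑² (λ u v → ⟦ (u <ᶠ v) ∧ arc x y u v ⟧)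
    ≡⟨ ∑²-cong {n} (λ u v → ⟦∧∧⟧ (does (x ≟ u)) (does (y ≟ v)) (u <ᶠ v)) ⟩
  ∑[ u < n ] ∑[ v < n ] (⟦ does (x ≟ u) ⟧ * (⟦ does (y ≟ v) ⟧ * ⟦ u <ᶠ v ⟧))
    ≡⟨ sum-cong-≗ {n} (λ u → sym (*-distribˡ-sum ⟦ does (x ≟ u) ⟧ (λ v → ⟦ does (y ≟ v) ⟧ * ⟦ u <ᶠ v ⟧))) ⟩
  ∑[ u < n ] (⟦ does (x ≟ u) ⟧ * ∑[ v < n ] (⟦ does (y ≟ v) ⟧ * ⟦ u <ᶠ v ⟧))
    ≡⟨ sum-cong-≗ {n} (λ u → cong (⟦ does (x ≟ u) ⟧ *_) (∑-point y (λ v → ⟦ u <ᶠ v ⟧))) ⟩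
  ∑[ u < n ] (⟦ does (x ≟ u) ⟧ * ⟦ u <ᶠ y ⟧)
    ≡⟨ ∑-point x (λ u → ⟦ u <ᶠ y ⟧) ⟩
  ⟦ x <ᶠ y ⟧ ∎
  where
  open ≡-Reasoning
  ⟦∧∧⟧ : ∀ a b c → ⟦ c ∧ (a ∧ b) ⟧ ≡ ⟦ a ⟧ * (⟦ b ⟧ * ⟦ c ⟧)
  ⟦∧∧⟧ true  true  true  = refl
  ⟦∧∧⟧ true  true  false = refl
  ⟦∧∧⟧ true  false true  = refl
  ⟦∧∧⟧ true  false false = refl
  ⟦∧∧⟧ false b     true  = refl
  ⟦∧∧⟧ false true  false = refl
  ⟦∧∧⟧ false false false = refl

⟦<ᵇ⟧+⟦>ᵇ⟧ : ∀ m n → m ≢ n → ⟦ m <ᵇ n ⟧ + ⟦ n <ᵇ m ⟧ ≡ 1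
⟦<ᵇ⟧+⟦>ᵇ⟧ zero    zero    m≢n = ⊥-elim (m≢n refl)
⟦<ᵇ⟧+⟦>ᵇ⟧ zero    (suc n) _   = refl
⟦<ᵇ⟧+⟦>ᵇ⟧ (suc m) zero    _   = refl
⟦<ᵇ⟧+⟦>ᵇ⟧ (suc m) (suc n) m≢n = ⟦<ᵇ⟧+⟦>ᵇ⟧ m n (m≢n ∘ cong suc)

IsEdge : Fin n → Fin n → Fin n → Fin n → Set
IsEdge x y u v = (x ≡ u × y ≡ v) ⊎ (x ≡ v × y ≡ u)

isEdge? : (x y u v : Fin n) → Dec (IsEdge x y u v)
isEdge? x y u v = (x ≟ u ×-dec y ≟ v) ⊎-dec (x ≟ v ×-dec y ≟ u)

edge : Fin n → Fin n → EdgeSet n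
edge x y u v = does (isEdge? x y u v)

does-true⇒ : ∀ {A : Set} (a? : Dec A) → does a? ≡ true → A
does-true⇒ (yes a) _ = a

does-false⇒ : ∀ {A : Set} (a? : Dec A) → does a? ≡ false → ¬ A
does-false⇒ (no ¬a) _ = ¬a

IsEdge-transport : (S : EdgeSet n) → IsSymmetric S → ∀ {x y u v} → IsEdge x y u v → S u v ≡ S x y
IsEdge-transport S S-sym (inj₁ (refl , refl)) = refl
IsEdge-transport S S-sym (inj₂ (refl , refl)) = S-sym _ _

esize-edge : {x y : Fin n} → x ≢ y → esize (edge x y) ≡ 1
esize-edge {n} {x} {y} x≢y = begin
  esize (edge x y)                  ≡⟨ esize-cong (λ u v → cong (arc x y u v ∨_) (∧-comm (does (x ≟ v)) _)) ⟩
  esize (arc x y ∪ arc y x)         ≡⟨ esize-∪ (arc x y) (arc y x) disjoint ⟩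
  esize (arc x y) + esize (arc y x) ≡⟨ cong₂ _+_ (esize-arc x y) (esize-arc y x) ⟩
  ⟦ x <ᶠ y ⟧ + ⟦ y <ᶠ x ⟧           ≡⟨ ⟦<ᵇ⟧+⟦>ᵇ⟧ (toℕ x) (toℕ y) (x≢y ∘ toℕ-injective) ⟩
  1                                 ∎
  where
  open ≡-Reasoning
  disjoint : ∀ u v → (arc x y ∩ arc y x) u v ≡ false
  disjoint u v with x ≟ u | y ≟ u
  ... | no _    | _       = refl
  ... | yes _   | no _    = ∧-zeroʳ _
  ... | yes x≡u | yes y≡u = ⊥-elim (x≢y (trans x≡u (sym y≡u)))

esize-edge-∩ : (S : EdgeSet n) → IsSymmetric S → {x y : Fin n} → x ≢ y → esize (edge x y ∩ S) ≡ ⟦ S x y ⟧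
esize-edge-∩ {n} S S-sym {x} {y} x≢y = trans (esize-cong on-edge) (restrict (S x y))
  where
  on-edge : ∀ u v → edge x y u v ∧ S u v ≡ edge x y u v ∧ S x y
  on-edge u v with edge x y u v in e
  ... | false = refl
  ... | true  = IsEdge-transport S S-sym (does-true⇒ (isEdge? x y u v) e)
  restrict : ∀ b → esize (λ u v → edge x y u v ∧ b) ≡ ⟦ b ⟧
  restrict true  = trans (esize-cong {n} (λ u v → ∧-identityʳ (edge x y u v))) (esize-edge x≢y)
  restrict false = trans (esize-cong {n} (λ u v → ∧-zeroʳ (edge x y u v))) (esize-∅ {n})

-- Walks

edgeOn? : (u v : Fin n) (ws : List (Fin n)) → Dec (EdgeOn u v ws)
edgeOn? u v []          = no λ ()
edgeOn? u v (x ∷ [])    = no λ ()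
edgeOn? u v (x ∷ y ∷ r) = isEdge? x y u v ⊎-dec edgeOn? u v (y ∷ r)

walkEdges : List (Fin n) → EdgeSet n
walkEdges ws u v = does (edgeOn? u v ws)

EdgeOn-sym : ∀ {u v : Fin n} ws → EdgeOn u v ws → EdgeOn v u ws
EdgeOn-sym (x ∷ y ∷ r) (inj₁ (inj₁ e)) = inj₁ (inj₂ e)
EdgeOn-sym (x ∷ y ∷ r) (inj₁ (inj₂ e)) = inj₁ (inj₁ e)
EdgeOn-sym (x ∷ y ∷ r) (inj₂ on)       = inj₂ (EdgeOn-sym (y ∷ r) on)

walkEdges-sym : (ws : List (Fin n)) → IsSymmetric (walkEdges ws)
walkEdges-sym ws u v = does-⇔ (mk⇔ (EdgeOn-sym ws) (EdgeOn-sym ws)) (edgeOn? u v ws) (edgeOn? v u ws)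

IsEdge⇒EdgeOn : ∀ {x y u v : Fin n} ws → IsEdge x y u v → EdgeOn u v ws → EdgeOn x y ws
IsEdge⇒EdgeOn ws (inj₁ (refl , refl)) on = on
IsEdge⇒EdgeOn ws (inj₂ (refl , refl)) on = EdgeOn-sym ws on

EdgeOn⇒∈ : ∀ {u v : Fin n} ws → EdgeOn u v ws → u ∈ ws × v ∈ ws
EdgeOn⇒∈ (x ∷ y ∷ r) (inj₁ (inj₁ (refl , refl))) = here refl , there (here refl)
EdgeOn⇒∈ (x ∷ y ∷ r) (inj₁ (inj₂ (refl , refl))) = there (here refl) , here refl
EdgeOn⇒∈ (x ∷ y ∷ r) (inj₂ on)                   = Product.map there there (EdgeOn⇒∈ (y ∷ r) on)

∈⇒EdgeOn : ∀ {z : Fin n} h y r → z ∈ (h ∷ y ∷ r) → ∃[ t ] EdgeOn z t (h ∷ y ∷ r)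
∈⇒EdgeOn h y r       (here refl)         = y , inj₁ (inj₁ (refl , refl))
∈⇒EdgeOn h y r       (there (here refl)) = h , inj₁ (inj₂ (refl , refl))
∈⇒EdgeOn h y (w ∷ r) (there (there z∈))  = Product.map₂ inj₂ (∈⇒EdgeOn y w r (there z∈))

DistinctEdges : List (Fin n) → Set
DistinctEdges []          = ⊤
DistinctEdges (x ∷ [])    = ⊤
DistinctEdges (x ∷ y ∷ r) = x ≢ y × ¬ EdgeOn x y (y ∷ r) × DistinctEdges (y ∷ r)

DistinctEdges⇒no-backtrack : ∀ {x y z : Fin n} {r} → DistinctEdges (x ∷ y ∷ z ∷ r) → x ≢ z
DistinctEdges⇒no-backtrack (_ , xy∉ , _) refl = xy∉ (inj₁ (inj₂ (refl , refl)))

Unique⇒head∉ : ∀ {x : Fin n} {xs} → Unique (x ∷ xs) → x ∉ xs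
Unique⇒head∉ (x∉ ∷ _) = All¬⇒¬Any x∉

Unique⇒DistinctEdges : (ws : List (Fin n)) → Unique ws → DistinctEdges ws
Unique⇒DistinctEdges []          _ = tt
Unique⇒DistinctEdges (x ∷ [])    _ = tt
Unique⇒DistinctEdges (x ∷ y ∷ r) U@((x≢y ∷ _) ∷ U′) =
  x≢y , (λ on → Unique⇒head∉ U (proj₁ (EdgeOn⇒∈ (y ∷ r) on))) , Unique⇒DistinctEdges (y ∷ r) U′

Unique-snoc : ∀ (xs : List (Fin n)) {w} → Unique xs → w ∉ xs → Unique (xs ++ w ∷ [])
Unique-snoc xs U w∉ = Unique.++⁺ U ([] ∷ []) λ { (w∈ , here refl) → w∉ w∈ }

Unique⇒head-edge : ∀ {h y : Fin n} {r v} → Unique (h ∷ y ∷ r) → EdgeOn h v (h ∷ y ∷ r) → v ≡ y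
Unique⇒head-edge _               (inj₁ (inj₁ (_ , refl)))   = refl
Unique⇒head-edge ((h≢y ∷ _) ∷ _) (inj₁ (inj₂ (refl , y≡h))) = ⊥-elim (h≢y (sym y≡h))
Unique⇒head-edge U               (inj₂ on)                  = ⊥-elim (Unique⇒head∉ U (proj₁ (EdgeOn⇒∈ _ on)))

lastOf : Fin n → List (Fin n) → Fin n
lastOf x []       = x
lastOf x (y ∷ ys) = lastOf y ys

lastOf-snoc : ∀ (x : Fin n) xs z → lastOf x (xs ++ z ∷ []) ≡ z
lastOf-snoc x []       z = refl
lastOf-snoc x (y ∷ xs) z = lastOf-snoc y xs z

lastOf-∈ : ∀ (x : Fin n) xs → lastOf x xs ∈ (x ∷ xs)
lastOf-∈ x []       = here refl
lastOf-∈ x (y ∷ xs) = there (lastOf-∈ y xs)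

nEdges-close : ∀ (x : Fin n) xs → nEdges (close (x ∷ xs)) ≡ length (x ∷ xs)
nEdges-close x xs = trans (length-++ xs) (+-comm (length xs) 1)

stepCount : EdgeSet n → List (Fin n) → ℕ
stepCount S []          = 0
stepCount S (x ∷ [])    = 0
stepCount S (x ∷ y ∷ r) = ⟦ S x y ⟧ + stepCount S (y ∷ r)

esize-walk : (S : EdgeSet n) → IsSymmetric S → (ws : List (Fin n)) → DistinctEdges ws →
  esize (walkEdges ws ∩ S) ≡ stepCount S ws
esize-walk {n} S S-sym []          _ = esize-∅ {n}
esize-walk {n} S S-sym (x ∷ [])    _ = esize-∅ {n}
esize-walk {n} S S-sym (x ∷ y ∷ r) (x≢y , xy∉r , distinct) = begin
  esize (walkEdges (x ∷ y ∷ r) ∩ S)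
    ≡⟨ esize-cong {n} (λ u v → ∧-distribʳ-∨ (S u v) (edge x y u v) (walkEdges (y ∷ r) u v)) ⟩
  esize ((edge x y ∩ S) ∪ (walkEdges (y ∷ r) ∩ S))
    ≡⟨ esize-∪ (edge x y ∩ S) (walkEdges (y ∷ r) ∩ S) disjoint ⟩
  esize (edge x y ∩ S) + esize (walkEdges (y ∷ r) ∩ S)
    ≡⟨ cong₂ _+_ (esize-edge-∩ S S-sym x≢y) (esize-walk S S-sym (y ∷ r) distinct) ⟩
  ⟦ S x y ⟧ + stepCount S (y ∷ r) ∎
  where
  open ≡-Reasoning
  disjoint : ∀ u v → ((edge x y ∩ S) ∩ (walkEdges (y ∷ r) ∩ S)) u v ≡ false
  disjoint u v with edge x y u v in e
  ... | false = refl
  ... | true rewrite dec-false (edgeOn? u v (y ∷ r))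
                       (xy∉r ∘ IsEdge⇒EdgeOn (y ∷ r) (does-true⇒ (isEdge? x y u v) e)) = ∧-zeroʳ (S u v)

Even⇒⌈/2⌉≡⌊/2⌋ : ∀ {m} → Even m → ⌈ m /2⌉ ≡ ⌊ m /2⌋
Even⇒⌈/2⌉≡⌊/2⌋ (k , refl) rewrite +-identityʳ k = trans (sym (n≡⌈n+n/2⌉ k)) (n≡⌊n+n/2⌋ k)

Odd⇒⌈/2⌉≡1+⌊/2⌋ : ∀ {m} → Odd m → ⌈ m /2⌉ ≡ suc ⌊ m /2⌋
Odd⇒⌈/2⌉≡1+⌊/2⌋ (k , refl) = cong suc (sym (Even⇒⌈/2⌉≡⌊/2⌋ (k , refl)))

Even-suc⇒Odd : ∀ {m} → Even (suc m) → Odd m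
Even-suc⇒Odd (suc k , eq) = k , trans (suc-injective eq) (+-suc k (k + 0))

Odd-suc⇒Even : ∀ {m} → Odd (suc m) → Even m
Odd-suc⇒Even (k , eq) = k , suc-injective eq

Odd⇒Even-suc : ∀ {m} → Odd m → Even (suc m)
Odd⇒Even-suc (k , refl) = suc k , cong suc (sym (+-suc k (k + 0)))

¬Even1 : ¬ Even 1
¬Even1 e with Even-suc⇒Odd e
... | _ , ()

-- Alternating walks

module Alternation {n} (A : ERel n) (B : EdgeSet n) (A-sym : ∀ {u v} → A u v → A v u) (B-sym : IsSymmetric B) where

  Alt : Bool → List (Fin n) → Set
  Alt = AltFrom A (toRel B)

  Step : Bool → Fin n → Fin n → Set
  Step true  = InDiff A (toRel B)
  Step false = InDiff (toRel B) A

  alt-uncons : ∀ {b x y r} → Alt b (x ∷ y ∷ r) → Step b x y × Alt (not b) (y ∷ r)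
  alt-uncons {true}  al = al
  alt-uncons {false} al = al

  StepKind : Fin n → Fin n → Set
  StepKind u v = (A u v × B u v ≡ false) ⊎ (B u v ≡ true × ¬ A u v)

  step-kind : ∀ {b x y u v} → Step b x y → IsEdge x y u v → StepKind u v
  step-kind {true}  (a , ¬b) (inj₁ (refl , refl)) = inj₁ (a , ¬-not ¬b)
  step-kind {true}  (a , ¬b) (inj₂ (refl , refl)) = inj₁ (A-sym a , ¬-not (¬b ∘ trans (B-sym _ _)))
  step-kind {false} (b , ¬a) (inj₁ (refl , refl)) = inj₂ (b , ¬a)
  step-kind {false} (b , ¬a) (inj₂ (refl , refl)) = inj₂ (trans (B-sym _ _) b , ¬a ∘ A-sym)

  alt-edge : ∀ {b u v} ws → Alt b ws → EdgeOn u v ws → StepKind u v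
  alt-edge {b} (x ∷ y ∷ r) al (inj₁ e)  = step-kind {b} (proj₁ (alt-uncons {b} al)) e
  alt-edge {b} (x ∷ y ∷ r) al (inj₂ on) = alt-edge (y ∷ r) (proj₂ (alt-uncons {b} al)) on

  aSteps bSteps : List (Fin n) → ℕ
  aSteps = stepCount (λ u v → not (B u v))
  bSteps = stepCount B

  halfUpIf : Bool → ℕ → ℕ
  halfUpIf true  m = ⌈ m /2⌉
  halfUpIf false m = ⌊ m /2⌋

  alt-aSteps : ∀ {b} ws → Alt b ws → aSteps ws ≡ halfUpIf b (nEdges ws)
  alt-aSteps {true}  []          _               = refl
  alt-aSteps {false} []          _               = refl
  alt-aSteps {true}  (x ∷ [])    _               = refl
  alt-aSteps {false} (x ∷ [])    _               = refl
  alt-aSteps {true}  (x ∷ y ∷ r) ((_ , ¬b) , al) = cong₂ _+_ (cong (⟦_⟧ ∘ not) (¬-not ¬b)) (alt-aSteps (y ∷ r) al)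
  alt-aSteps {false} (x ∷ y ∷ r) ((b , _) , al)  = cong₂ _+_ (cong (⟦_⟧ ∘ not) b) (alt-aSteps (y ∷ r) al)

  alt-bSteps : ∀ {b} ws → Alt b ws → bSteps ws ≡ halfUpIf (not b) (nEdges ws)
  alt-bSteps {true}  []          _               = refl
  alt-bSteps {false} []          _               = refl
  alt-bSteps {true}  (x ∷ [])    _               = refl
  alt-bSteps {false} (x ∷ [])    _               = refl
  alt-bSteps {true}  (x ∷ y ∷ r) ((_ , ¬b) , al) = cong₂ _+_ (cong ⟦_⟧ (¬-not ¬b)) (alt-bSteps (y ∷ r) al)
  alt-bSteps {false} (x ∷ y ∷ r) ((b , _) , al)  = cong₂ _+_ (cong ⟦_⟧ b) (alt-bSteps (y ∷ r) al)

  halfUpIf-even : ∀ b {m} → Even m → halfUpIf b m ≡ ⌊ m /2⌋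
  halfUpIf-even true  e = Even⇒⌈/2⌉≡⌊/2⌋ e
  halfUpIf-even false _ = refl

  alt-balanced : ∀ {b} ws → Alt b ws → Even (nEdges ws) → aSteps ws ≡ bSteps ws
  alt-balanced {b} ws al e = begin
    aSteps ws                    ≡⟨ alt-aSteps ws al ⟩
    halfUpIf b (nEdges ws)       ≡⟨ halfUpIf-even b e ⟩
    ⌊ nEdges ws /2⌋              ≡⟨ sym (halfUpIf-even (not b) e) ⟩
    halfUpIf (not b) (nEdges ws) ≡⟨ sym (alt-bSteps ws al) ⟩
    bSteps ws                    ∎
    where open ≡-Reasoning

  alt-even-aSteps>0 : ∀ {b} ws → Alt b ws → Even (nEdges ws) → 2 ≤ nEdges ws → 0 < aSteps ws
  alt-even-aSteps>0 {b} ws al e 2≤m rewrite alt-aSteps ws al | halfUpIf-even b e = ⌊/2⌋>0 2≤m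
    where
    ⌊/2⌋>0 : ∀ {m} → 2 ≤ m → 0 < ⌊ m /2⌋
    ⌊/2⌋>0 (s≤s (s≤s _)) = s≤s z≤n

  alt-odd : ∀ ws → Alt true ws → Odd (nEdges ws) → aSteps ws ≡ suc (bSteps ws)
  alt-odd ws al o = trans (alt-aSteps ws al) (trans (Odd⇒⌈/2⌉≡1+⌊/2⌋ o) (cong suc (sym (alt-bSteps ws al))))

  lastStep : Bool → List (Fin n) → Bool
  lastStep b []              = b
  lastStep b (x ∷ [])        = b
  lastStep b (x ∷ y ∷ [])    = b
  lastStep b (x ∷ y ∷ z ∷ r) = lastStep (not b) (y ∷ z ∷ r)

  lastStep-even : ∀ b x y r → Even (nEdges (x ∷ y ∷ r)) → lastStep b (x ∷ y ∷ r) ≡ not b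
  lastStep-odd  : ∀ b x y r → Odd (nEdges (x ∷ y ∷ r)) → lastStep b (x ∷ y ∷ r) ≡ b
  lastStep-even b x y []      e = ⊥-elim (¬Even1 e)
  lastStep-even b x y (z ∷ r) e = lastStep-odd (not b) y z r (Even-suc⇒Odd e)
  lastStep-odd  b x y []      _ = refl
  lastStep-odd  b x y (z ∷ r) o = trans (lastStep-even (not b) y z r (Odd-suc⇒Even o)) (not-involutive b)

  alt-snoc : ∀ {b} h y r w → Alt b (h ∷ y ∷ r) → Step (not (lastStep b (h ∷ y ∷ r))) (lastOf y r) w →
    Alt b (h ∷ y ∷ r ++ w ∷ [])
  alt-snoc {true}  h y []      w (s , _)  st = s , st , tt
  alt-snoc {false} h y []      w (s , _)  st = s , st , tt
  alt-snoc {true}  h y (z ∷ r) w (s , al) st = s , alt-snoc y z r w al st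
  alt-snoc {false} h y (z ∷ r) w (s , al) st = s , alt-snoc y z r w al st

  HasBEdge : List (Fin n) → Fin n → Set
  HasBEdge ws x = ∃[ y ] EdgeOn x y ws × B x y ≡ true

  AEnd : Bool → Fin n → List (Fin n) → Fin n → Set
  AEnd b h r x = (x ≡ h × b ≡ true) ⊎ (x ≡ lastOf h r × lastStep b (h ∷ r) ≡ true)

  A-endpoint : ∀ {b x w} h r → Alt b (h ∷ r) → EdgeOn x w (h ∷ r) → A x w → HasBEdge (h ∷ r) x ⊎ AEnd b h r x
  A-endpoint {false} h (y ∷ r)     ((_ , ¬a) , _)    (inj₁ (inj₁ (refl , refl))) a = ⊥-elim (¬a a)
  A-endpoint {false} h (y ∷ r)     ((_ , ¬a) , _)    (inj₁ (inj₂ (refl , refl))) a = ⊥-elim (¬a (A-sym a))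
  A-endpoint {true}  h (y ∷ r)     _                 (inj₁ (inj₁ (refl , refl))) a = inj₂ (inj₁ (refl , refl))
  A-endpoint {true}  h (y ∷ [])    _                 (inj₁ (inj₂ (refl , refl))) a = inj₂ (inj₂ (refl , refl))
  A-endpoint {true}  h (y ∷ z ∷ r) (_ , (b , _) , _) (inj₁ (inj₂ (refl , refl))) a =
    inj₁ (z , inj₂ (inj₁ (inj₁ (refl , refl))) , b)
  A-endpoint {true}  h (y ∷ z ∷ r) (_ , al) (inj₂ on) a with A-endpoint y (z ∷ r) al on a
  ... | inj₁ (y′ , on′ , b)    = inj₁ (y′ , inj₂ on′ , b)
  ... | inj₂ (inj₂ end)        = inj₂ (inj₂ end)
  A-endpoint {false} h (y ∷ z ∷ r) ((b , _) , al) (inj₂ on) a with A-endpoint y (z ∷ r) al on a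
  ... | inj₁ (y′ , on′ , b′)   = inj₁ (y′ , inj₂ on′ , b′)
  ... | inj₂ (inj₁ (refl , _)) = inj₁ (h , inj₁ (inj₂ (refl , refl)) , trans (B-sym _ _) b)
  ... | inj₂ (inj₂ end)        = inj₂ (inj₂ end)

  lastStep-B : ∀ {b} h y r → Alt b (h ∷ y ∷ r) → lastStep b (h ∷ y ∷ r) ≡ false → HasBEdge (h ∷ y ∷ r) (lastOf y r)
  lastStep-B {true}  h y []      _             ()
  lastStep-B {false} h y []      ((b , _) , _) _    = h , inj₁ (inj₂ (refl , refl)) , trans (B-sym _ _) b
  lastStep-B {b}     h y (z ∷ r) al            last with lastStep-B y z r (proj₂ (alt-uncons {b} al)) last
  ... | x , on , bx = x , inj₂ on , bx

  module InMatching (M : EdgeSet n) (M-sym : IsSymmetric M)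
    (M-match : ∀ u v w → M u v ≡ true → M u w ≡ true → v ≡ w) (A⊆M : ∀ {u v} → A u v → M u v ≡ true) where

    private
      M-at : ∀ {x y u v} → IsEdge x y u v → M u v ≡ true → M y x ≡ true
      M-at e m = trans (M-sym _ _) (trans (sym (IsEdge-transport M M-sym e)) m)

      B-after-A∉M : ∀ {x y z u v} → Step true x y → IsEdge y z u v → M u v ≡ true →
        DistinctEdges (x ∷ y ∷ z ∷ []) → ⊥
      B-after-A∉M (a , _) e m d =
        DistinctEdges⇒no-backtrack {r = []} d (M-match _ _ _ (trans (M-sym _ _) (A⊆M a)) (trans (M-sym _ _) (M-at e m)))

    B∈M⇒single-step : ∀ {b u v} ws → Alt b ws → DistinctEdges ws → EdgeOn u v ws → B u v ≡ true →
      M u v ≡ true → nEdges ws ≡ 1 × b ≡ false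
    B∈M⇒single-step {true}  (x ∷ y ∷ r) ((_ , ¬b) , _) _ (inj₁ e) b m =
      ⊥-elim (¬b (trans (sym (IsEdge-transport B B-sym e)) b))
    B∈M⇒single-step {false} (x ∷ y ∷ []) _ _ (inj₁ e) b m = refl , refl
    B∈M⇒single-step {false} (x ∷ y ∷ z ∷ r) (_ , (a , _) , _) d (inj₁ e) b m =
      ⊥-elim (DistinctEdges⇒no-backtrack d (M-match y x z (M-at e m) (A⊆M a)))
    B∈M⇒single-step (x ∷ y ∷ []) _ _ (inj₂ ()) _ _
    B∈M⇒single-step {true}  (x ∷ y ∷ z ∷ []) (st , _) d (inj₂ (inj₁ e)) b m = ⊥-elim (B-after-A∉M st e m d)
    B∈M⇒single-step {false} (x ∷ y ∷ z ∷ []) (_ , (_ , ¬b) , _) d (inj₂ (inj₁ e)) b m =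
      ⊥-elim (¬b (trans (sym (IsEdge-transport B B-sym e)) b))
    B∈M⇒single-step (x ∷ y ∷ z ∷ []) _ _ (inj₂ (inj₂ ())) _ _
    B∈M⇒single-step {b} (x ∷ y ∷ z ∷ w ∷ r) al (_ , _ , d) (inj₂ on) bt m
      with B∈M⇒single-step (y ∷ z ∷ w ∷ r) (proj₂ (alt-uncons {b} al)) d on bt m
    ... | () , _

    B-steps∉M : ∀ {b u v} ws → Alt b ws → DistinctEdges ws → 0 < aSteps ws → EdgeOn u v ws → B u v ≡ true →
      M u v ≡ false
    B-steps∉M ws al d aSteps>0 on b = ¬-not B∉M
      where
      B∉M : M _ _ ≢ true
      B∉M m with B∈M⇒single-step ws al d on b m
      ... | 1≡m , refl = <-irrefl refl (subst (0 <_) (trans (alt-aSteps ws al) (cong ⌊_/2⌋ 1≡m)) aSteps>0)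

-- The exchange argument

InM2-exchange : ∀ {n} {G : Graph n} {H H' K : EdgeSet n} →
  InM2 G H H' → InB2 G H K → esize H' ≤ esize K → InM2 G H K
InM2-exchange {H = H} {H'} {K} ((_ , λ₂-max) , α₂-max) HK H'≤K =
  (HK , λ L L′ LL′ → ≤-trans (λ₂-max L L′ LL′) (≤-reflexive (sym same-sum))) ,
  λ L L′ LL′ eq → α₂-max L L′ LL′ (trans eq same-sum)
  where
  same-sum : esize H + esize K ≡ esize H + esize H'
  same-sum = ≤-antisym (λ₂-max H K HK) (+-monoʳ-≤ (esize H) H'≤K)

xor-true : ∀ s t → s xor t ≡ true → (s ≡ true × t ≡ false) ⊎ (s ≡ false × t ≡ true)
xor-true true  false _ = inj₁ (refl , refl)
xor-true false true  _ = inj₂ (refl , refl)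

module Exchange {n} (G : Graph n) (H H' M : EdgeSet n) (setting : StandingSetting G H H' M)
  (A : ERel n) (A-sym : ∀ {u v} → A u v → A v u)
  (A⊆M : ∀ {u v} → A u v → M u v ≡ true) (A∩H≡∅ : ∀ {u v} → A u v → H u v ≡ false) where

  H-H'∈M₂ : InM2 G H H'
  H-H'∈M₂ = proj₁ setting

  H-matching : IsMatching G H
  H-matching = proj₁ (proj₁ (proj₁ H-H'∈M₂))

  H'-matching : IsMatching G H'
  H'-matching = proj₁ (proj₂ (proj₁ (proj₁ H-H'∈M₂)))

  H∩H'≡∅ : ∀ u v → H u v ≡ true → H' u v ≡ false
  H∩H'≡∅ = proj₂ (proj₂ (proj₁ (proj₁ H-H'∈M₂)))

  M-maximum : IsMaximumMatching G M
  M-maximum = proj₁ (proj₂ setting)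

  M-matching : IsMatching G M
  M-matching = proj₁ M-maximum

  M∩H'-maximal : ∀ K K' N → InM2 G K K' → IsMaximumMatching G N →
    esize (N ∩ K) ≡ esize (M ∩ H) → esize (N ∩ K') ≤ esize (M ∩ H')
  M∩H'-maximal = proj₂ (proj₂ (proj₂ setting))

  open Alternation A H' A-sym (proj₁ H'-matching) public
  open InMatching M (proj₁ M-matching) (proj₂ (proj₂ M-matching)) A⊆M public

  H'Closed : List (Fin n) → Set
  H'Closed ws = ∀ {u v w} → EdgeOn u v ws → A u v → H' u w ≡ true → EdgeOn u w ws

  module Swap {b} (ws : List (Fin n)) (al : Alt b ws) (distinct : DistinctEdges ws) (closed : H'Closed ws) where

    walk-A : ∀ {u v} → H' u v ≡ false → walkEdges ws u v ≡ true → A u v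
    walk-A {u} {v} ¬h on with alt-edge ws al (does-true⇒ (edgeOn? u v ws) on)
    ... | inj₁ (a , _) = a
    ... | inj₂ (h , _) with trans (sym h) ¬h
    ...   | ()

    swap-matching : IsMatching G (H' Δ walkEdges ws)
    swap-matching = symmetric , ⊆adj , unique
      where
      symmetric : IsSymmetric (H' Δ walkEdges ws)
      symmetric u v = cong₂ _xor_ (proj₁ H'-matching u v) (walkEdges-sym ws u v)
      ⊆adj : ∀ u v → (H' Δ walkEdges ws) u v ≡ true → adj G u v ≡ true
      ⊆adj u v e with xor-true (H' u v) (walkEdges ws u v) e
      ... | inj₁ (h , _)   = proj₁ (proj₂ H'-matching) u v h
      ... | inj₂ (¬h , on) = proj₁ (proj₂ M-matching) u v (A⊆M (walk-A ¬h on))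
      off-walk : ∀ {u v w} → A u v → walkEdges ws u v ≡ true → H' u w ≡ true → walkEdges ws u w ≡ false → ⊥
      off-walk a on h off = does-false⇒ (edgeOn? _ _ ws) off (closed (does-true⇒ (edgeOn? _ _ ws) on) a h)
      unique : ∀ u v w → (H' Δ walkEdges ws) u v ≡ true → (H' Δ walkEdges ws) u w ≡ true → v ≡ w
      unique u v w e e′ with xor-true (H' u v) (walkEdges ws u v) e | xor-true (H' u w) (walkEdges ws u w) e′
      ... | inj₁ (h , _)   | inj₁ (h′ , _)    = proj₂ (proj₂ H'-matching) u v w h h′
      ... | inj₂ (¬h , on) | inj₂ (¬h′ , on′) = proj₂ (proj₂ M-matching) u v w (A⊆M (walk-A ¬h on)) (A⊆M (walk-A ¬h′ on′))
      ... | inj₂ (¬h , on) | inj₁ (h′ , off′) = ⊥-elim (off-walk (walk-A ¬h on) on h′ off′)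
      ... | inj₁ (h , off) | inj₂ (¬h′ , on′) = ⊥-elim (off-walk (walk-A ¬h′ on′) on′ h off)

    swap-InB2 : InB2 G H (H' Δ walkEdges ws)
    swap-InB2 = H-matching , swap-matching , disjoint
      where
      disjoint : ∀ u v → H u v ≡ true → (H' Δ walkEdges ws) u v ≡ false
      disjoint u v h with H∩H'≡∅ u v h | walkEdges ws u v in on
      ... | ¬h′ | false rewrite ¬h′ = refl
      ... | ¬h′ | true with trans (sym h) (A∩H≡∅ (walk-A ¬h′ on))
      ...   | ()

    esize-walk∖H' : esize (walkEdges ws ∖ H') ≡ aSteps ws
    esize-walk∖H' = esize-walk (λ u v → not (H' u v)) (λ u v → cong not (proj₁ H'-matching u v)) ws distinct

    esize-swap : esize (H' Δ walkEdges ws) + bSteps ws ≡ esize H' + aSteps ws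
    esize-swap = begin
      esize (H' Δ walkEdges ws) + bSteps ws
        ≡⟨ cong (esize (H' Δ walkEdges ws) +_) (sym (esize-walk H' (proj₁ H'-matching) ws distinct)) ⟩
      esize (H' Δ walkEdges ws) + esize (walkEdges ws ∩ H')
        ≡⟨ esize-Δ H' (walkEdges ws) ⟩
      esize H' + esize (walkEdges ws ∖ H')
        ≡⟨ cong (esize H' +_) esize-walk∖H' ⟩
      esize H' + aSteps ws ∎
      where open ≡-Reasoning

    esize-M∩swap : 0 < aSteps ws → esize (M ∩ (H' Δ walkEdges ws)) ≡ esize (M ∩ H') + aSteps ws
    esize-M∩swap aSteps>0 = begin
      esize (M ∩ (H' Δ walkEdges ws))            ≡⟨ esize-cong {n} split ⟩
      esize ((M ∩ H') ∪ (walkEdges ws ∖ H'))     ≡⟨ esize-∪ (M ∩ H') (walkEdges ws ∖ H') disjoint ⟩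
      esize (M ∩ H') + esize (walkEdges ws ∖ H') ≡⟨ cong (esize (M ∩ H') +_) esize-walk∖H' ⟩
      esize (M ∩ H') + aSteps ws                 ∎
      where
      open ≡-Reasoning
      split-at : ∀ m h w → (w ≡ true → h ≡ true → m ≡ false) → (w ≡ true → h ≡ false → m ≡ true) →
        m ∧ (h xor w) ≡ (m ∧ h) ∨ (w ∧ not h)
      split-at m true  false _ _ = sym (∨-identityʳ (m ∧ true))
      split-at m false false _ _ = sym (∨-identityʳ (m ∧ false))
      split-at m true  true  f _ rewrite f refl refl = refl
      split-at m false true  _ t rewrite t refl refl = refl
      split : ∀ u v → (M ∩ (H' Δ walkEdges ws)) u v ≡ ((M ∩ H') ∪ (walkEdges ws ∖ H')) u v
      split u v = split-at (M u v) (H' u v) (walkEdges ws u v)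
        (λ on h → B-steps∉M ws al distinct aSteps>0 (does-true⇒ (edgeOn? u v ws) on) h)
        (λ on ¬h → A⊆M (walk-A ¬h on))
      disjoint-at : ∀ m h w → (m ∧ h) ∧ (w ∧ not h) ≡ false
      disjoint-at true  true  w = ∧-zeroʳ w
      disjoint-at true  false w = refl
      disjoint-at false h     w = refl
      disjoint : ∀ u v → ((M ∩ H') ∩ (walkEdges ws ∖ H')) u v ≡ false
      disjoint u v = disjoint-at (M u v) (H' u v) (walkEdges ws u v)

  no-improving-walk : ∀ {b} ws → Alt b ws → DistinctEdges ws → H'Closed ws →
    bSteps ws ≤ aSteps ws → 0 < aSteps ws → ⊥
  no-improving-walk ws al distinct closed b≤a aSteps>0 =
    <⇒≱ (subst (esize (M ∩ H') <_) (sym (esize-M∩swap aSteps>0)) (m<m+n (esize (M ∩ H')) aSteps>0))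
        (M∩H'-maximal H (H' Δ walkEdges ws) M (InM2-exchange {n} {G} H-H'∈M₂ swap-InB2 H'≤swap) M-maximum refl)
    where
    open Swap ws al distinct closed
    H'≤swap : esize H' ≤ esize (H' Δ walkEdges ws)
    H'≤swap = +-cancelʳ-≤ (bSteps ws) _ _ (≤-trans (+-monoʳ-≤ (esize H') b≤a) (≤-reflexive (sym esize-swap)))

-- Alternating cycles and maximal paths

module NoAlternatingStructure {n} (G : Graph n) (H H' M : EdgeSet n) (setting : StandingSetting G H H' M)
  (A : ERel n) (A-sym : ∀ {u v} → A u v → A v u)
  (A⊆M : ∀ {u v} → A u v → M u v ≡ true) (A∩H≡∅ : ∀ {u v} → A u v → H u v ≡ false) where

  open Exchange G H H' M setting A A-sym A⊆M A∩H≡∅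
  open import Data.List.Membership.DecPropositional (_≟_ {n}) using (_∈?_)

  H'-sym : ∀ {u v} → H' u v ≡ true → H' v u ≡ true
  H'-sym {u} {v} = trans (proj₁ H'-matching v u)

  H'-irrefl : ∀ {u} → H' u u ≢ true
  H'-irrefl {u} h with trans (sym (proj₁ (proj₂ H'-matching) u u h)) (irrefl G u)
  ... | ()

  A-neighbour-unique : ∀ {u v w} → A u v → A u w → v ≡ w
  A-neighbour-unique a a′ = proj₂ (proj₂ M-matching) _ _ _ (A⊆M a) (A⊆M a′)

  HasBEdge⇒closed : ∀ {ws u w} → HasBEdge ws u → H' u w ≡ true → EdgeOn u w ws
  HasBEdge⇒closed (y , on , b) h rewrite proj₂ (proj₂ H'-matching) _ _ _ h b = on

  no-alternating-cycle : ∀ vs → ¬ InC A (toRel H') vs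
  no-alternating-cycle []           (_ , () , _)
  no-alternating-cycle (x ∷ [])     (_ , s≤s () , _)
  no-alternating-cycle (x ∷ y ∷ []) (_ , s≤s (s≤s ()) , _)
  no-alternating-cycle (x ∷ y ∷ z ∷ r) (U , _ , even , b , al) =
    no-improving-walk c al distinct closed (≤-reflexive (sym (alt-balanced c al even-c)))
      (alt-even-aSteps>0 c al even-c (s≤s (s≤s z≤n)))
    where
    c : List (Fin n)
    c = close (x ∷ y ∷ z ∷ r)
    even-c : Even (nEdges c)
    even-c = subst Even (sym (nEdges-close x (y ∷ z ∷ r))) even
    U-tail : Unique (y ∷ z ∷ r ++ x ∷ [])
    U-tail = Unique-snoc (y ∷ z ∷ r) (AllPairs.tail U) (Unique⇒head∉ U)
    distinct : DistinctEdges c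
    distinct = (λ x≡y → Unique⇒head∉ U (here x≡y)) ,
               (λ on → Unique⇒head∉ U (there (here (Unique⇒head-edge U-tail (EdgeOn-sym _ on))))) ,
               Unique⇒DistinctEdges _ U-tail
    last-c≡x : lastOf y (z ∷ r ++ x ∷ []) ≡ x
    last-c≡x = lastOf-snoc y (z ∷ r) x
    x-has-B : ∀ {b′} → Alt b′ c → HasBEdge c x
    x-has-B {true}  al′ = subst (HasBEdge c) last-c≡x
      (lastStep-B {true} x y (z ∷ r ++ x ∷ []) al′ (lastStep-even true x y (z ∷ r ++ x ∷ []) even-c))
    x-has-B {false} ((h , _) , _) = y , inj₁ (inj₁ (refl , refl)) , h
    closed : H'Closed c
    closed on a h with A-endpoint x _ al on a
    ... | inj₁ has-B             = HasBEdge⇒closed has-B h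
    ... | inj₂ (inj₁ (refl , _)) = HasBEdge⇒closed (x-has-B al) h
    ... | inj₂ (inj₂ (refl , _)) = HasBEdge⇒closed (subst (HasBEdge c) (sym last-c≡x) (x-has-B al)) h

  module MaximalPath {b} (h y : Fin n) (r : List (Fin n)) (al : Alt b (h ∷ y ∷ r)) (U : Unique (h ∷ y ∷ r))
    (maximal : ¬ (∃[ ws ] AltPath A (toRel H') ws × ProperSubpath (h ∷ y ∷ r) ws)) where

    ws : List (Fin n)
    ws = h ∷ y ∷ r

    EndsJoined : Set
    EndsJoined = b ≡ true × lastStep b ws ≡ true × H' (lastOf y r) h ≡ true

    extension : ∀ {u w} → AEnd b h (y ∷ r) u → w ∉ ws → H' u w ≡ true → ¬ A u w →
      ∃[ ws′ ] AltPath A (toRel H') ws′ × ProperSubpath ws ws′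
    extension {w = w} (inj₁ (refl , refl)) w∉ hw ¬a =
      w ∷ ws , (¬Any⇒All¬ ws w∉ ∷ U , s≤s (s≤s z≤n) , false , (H'-sym hw , ¬a ∘ A-sym) , al) ,
      ≤-refl , inj₁ (w ∷ [] , [] , cong (w ∷_) (sym (++-identityʳ ws)))
    extension {w = w} (inj₂ (refl , last-A)) w∉ hw ¬a =
      ws ++ w ∷ [] ,
      (Unique-snoc ws U w∉ , s≤s (s≤s z≤n) , b ,
       alt-snoc h y r w al (subst (λ t → Step (not t) _ w) (sym last-A) (hw , ¬a))) ,
      ≤-reflexive (trans (+-comm 1 (length ws)) (sym (length-++ ws))) , inj₁ ([] , w ∷ [] , refl)

    H'-neighbour-on-walk : ∀ {u w} → w ∈ ws → H' w u ≡ true → EdgeOn u w ws ⊎ AEnd b h (y ∷ r) w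
    H'-neighbour-on-walk w∈ hw with ∈⇒EdgeOn h y r w∈
    ... | z , on with alt-edge ws al on
    ...   | inj₂ (hz , _) rewrite proj₂ (proj₂ H'-matching) _ _ _ hw hz = inj₁ (EdgeOn-sym ws on)
    ...   | inj₁ (a , _) with A-endpoint h (y ∷ r) al on a
    ...     | inj₁ has-B = inj₁ (EdgeOn-sym ws (HasBEdge⇒closed has-B hw))
    ...     | inj₂ end   = inj₂ end

    ends-not-joined : ¬ EndsJoined → ∀ {u w} → AEnd b h (y ∷ r) u → AEnd b h (y ∷ r) w → H' u w ≡ true → ⊥
    ends-not-joined _        (inj₁ (refl , _))  (inj₁ (refl , _))  hw = H'-irrefl hw
    ends-not-joined _        (inj₂ (refl , _))  (inj₂ (refl , _))  hw = H'-irrefl hw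
    ends-not-joined unjoined (inj₁ (refl , bt)) (inj₂ (refl , lt)) hw = unjoined (bt , lt , H'-sym hw)
    ends-not-joined unjoined (inj₂ (refl , lt)) (inj₁ (refl , bt)) hw = unjoined (bt , lt , hw)

    closed : ¬ EndsJoined → H'Closed ws
    closed unjoined {u} {v} {w} on a hw with A-endpoint h (y ∷ r) al on a
    ... | inj₁ has-B = HasBEdge⇒closed has-B hw
    ... | inj₂ end with w ∈? ws
    ...   | no w∉  = ⊥-elim (maximal (extension end w∉ hw ¬a))
      where
      ¬a : ¬ A u w
      ¬a a′ = w∉ (subst (_∈ ws) (A-neighbour-unique a a′) (proj₂ (EdgeOn⇒∈ ws on)))
    ...   | yes w∈ with H'-neighbour-on-walk w∈ (H'-sym hw)
    ...     | inj₁ on′  = on′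
    ...     | inj₂ end′ = ⊥-elim (ends-not-joined unjoined end end′ hw)

  no-even-maximal-path : ∀ vs → ¬ InPe A (toRel H') vs
  no-even-maximal-path []           (((_ , () , _) , _) , _)
  no-even-maximal-path (x ∷ [])     (((_ , s≤s () , _) , _) , _)
  no-even-maximal-path (h ∷ y ∷ []) (_ , even) = ¬Even1 even
  no-even-maximal-path (h ∷ y ∷ z ∷ r) (((U , _ , b , al) , maximal) , even) =
    no-improving-walk ws al (Unique⇒DistinctEdges ws U) (closed unjoined)
      (≤-reflexive (sym (alt-balanced ws al even))) (alt-even-aSteps>0 ws al even (s≤s (s≤s z≤n)))
    where
    open MaximalPath h y (z ∷ r) al U maximal
    unjoined : ¬ EndsJoined
    unjoined (refl , last-A , _) with trans (sym (lastStep-even true h y (z ∷ r) even)) last-A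
    ... | ()

  odd-A-path-unjoined : ∀ h y r → Alt true (h ∷ y ∷ r) → Unique (h ∷ y ∷ r) → Odd (nEdges (h ∷ y ∷ r)) →
    lastStep true (h ∷ y ∷ r) ≡ true → H' (lastOf y r) h ≡ true → ⊥
  odd-A-path-unjoined h y []      ((_ , ¬h) , _) _ _   _      joined = ¬h (H'-sym joined)
  odd-A-path-unjoined h y (z ∷ r) al             U odd last-A joined =
    no-alternating-cycle (h ∷ y ∷ z ∷ r)
      (U , s≤s (s≤s (s≤s z≤n)) , Odd⇒Even-suc odd , true ,
       alt-snoc h y (z ∷ r) h al (subst (λ t → Step (not t) (lastOf z r) h) (sym last-A) (joined , ¬a)))
    where
    ¬a : ¬ A (lastOf z r) h
    ¬a a = Unique⇒head∉ (AllPairs.tail U)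
      (subst (_∈ z ∷ r) (sym (A-neighbour-unique (proj₁ (proj₁ al)) (A-sym a))) (lastOf-∈ z r))

  no-odd-maximal-A-path : ∀ vs → ¬ InPoA A (toRel H') vs
  no-odd-maximal-A-path []          (((_ , () , _) , _) , _)
  no-odd-maximal-A-path (x ∷ [])    (((_ , s≤s () , _) , _) , _)
  no-odd-maximal-A-path (h ∷ y ∷ r) (((U , _) , maximal) , odd , al) =
    no-improving-walk {true} ws al (Unique⇒DistinctEdges ws U)
      (closed λ (_ , last-A , joined) → odd-A-path-unjoined h y r al U odd last-A joined)
      (≤-trans (n≤1+n _) (≤-reflexive (sym a≡1+b))) (subst (0 <_) (sym a≡1+b) (s≤s z≤n))
    where
    open MaximalPath {true} h y r al U maximal
    a≡1+b : aSteps ws ≡ suc (bSteps ws)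
    a≡1+b = alt-odd ws al odd

module _ {n} (M H : EdgeSet n) (M-sym : IsSymmetric M) where

  MA-sym : ∀ {u v} → MA M H u v → MA M H v u
  MA-sym (m , vs , path , on) = trans (M-sym _ _) m , vs , path , EdgeOn-sym vs on

  MA∩H≡∅ : IsSymmetric H → ∀ {u v} → MA M H u v → H u v ≡ false
  MA∩H≡∅ H-sym (m , vs , (_ , _ , al) , on) with Alternation.alt-edge (toRel M) H (trans (M-sym _ _)) H-sym vs al on
  ... | inj₁ (_ , ¬h) = ¬h
  ... | inj₂ (_ , ¬m) = ⊥-elim (¬m m)

lemma3 : ∀ {n} (G : Graph n) (H H' M : EdgeSet n) →
    StandingSetting G H H' M →
    (¬ (∃[ vs ] InC (MA M H) (toRel H') vs)) ×
    (¬ (∃[ vs ] InPe (MA M H) (toRel H') vs)) ×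
    (¬ (∃[ vs ] InPoA (MA M H) (toRel H') vs))
lemma3 G H H' M setting =
  uncurry no-alternating-cycle , uncurry no-even-maximal-path , uncurry no-odd-maximal-A-path
  where
  M-sym : IsSymmetric M
  M-sym = proj₁ (proj₁ (proj₁ (proj₂ setting)))
  H-sym : IsSymmetric H
  H-sym = proj₁ (proj₁ (proj₁ (proj₁ (proj₁ setting))))
  open NoAlternatingStructure G H H' M setting (MA M H) (MA-sym M H M-sym) proj₁ (MA∩H≡∅ M H M-sym H-sym)
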